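{- $\mathsf{MGrz}\vee\mathsf{LKur}$ is not a modal companion of $\mathsf{MIPC}$.
   Context: $\mathcal{L}_{\forall\exists}$ is the intuitionistic propositional language with modalities $\forall,\exists$; $\mathsf{MIPC}$ is the smallest set of $\mathcal{L}_{\forall\exists}$-formulas containing all intuitionistic propositional theorems, $\forall(p\wedge q)\leftrightarrow(\forall p\wedge\forall q)$, $\forall p\to p$, $\forall p\to\forall\forall p$, $\exists(p\vee q)\leftrightarrow(\exists p\vee\exists q)$, $p\to\exists p$, $\exists\exists p\to\exists p$, $(\exists p\wedge\exists q)\to\exists(\exists p\wedge q)$, $\exists\forall p\to\forall p$, $\exists p\to\forall\exists p$, closed under modus ponens, substitution and $\varphi/\forall\varphi$. $\mathsf{MS4}$ is the smallest set of formulas in the classical language with modalities $\Box,\forall$ ($\Diamond=\neg\Box\neg$, $\exists=\neg\forall\neg$) containing classical tautologies, $\mathsf{S4}$ axioms for $\Box$, $\mathsf{S5}$ axioms for $\forall$, and $\Box\forall p\to\forall\Box p$, closed under modus ponens, substitution, and necessitation for $\Box$ and $\forall$; extensions of $\mathsf{MS4}$ are such sets containing it; $\mathsf{MS4}+\chi$ is the least extension containing $\chi$, and $\mathsf{M}_1\vee\mathsf{M}_2$ the least extension containing both. $\mathsf{MGrz}=\mathsf{MS4}+(\Box(\Box(p\to\Box p)\to p)\to p)$, $\mathsf{LKur}=\mathsf{MS4}+(\Box\forall\Diamond\Box p\to\Diamond\forall p)$. Gödel translation: $\bot^t=\bot$, $p^t=\Box p$, $(\varphi\wedge\psi)^t=\varphi^t\wedge\psi^t$,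 $(\varphi\vee\psi)^t=\varphi^t\vee\psi^t$, $(\varphi\to\psi)^t=\Box(\neg\varphi^t\vee\psi^t)$, $(\forall\varphi)^t=\Box\forall\varphi^t$, $(\exists\varphi)^t=\exists\varphi^t$. An extension $\mathsf{M}$ of $\mathsf{MS4}$ is a modal companion of $\mathsf{MIPC}$ if for all $\mathcal{L}_{\forall\exists}$-formulas $\varphi$: $\mathsf{MIPC}\vdash\varphi$ iff $\mathsf{M}\vdash\varphi^t$. -}

module Defs where

open import Data.Nat using (ℕ)
open import Data.Product using (_×_)
open import Data.Sum using (_⊎_)
open import Relation.Binary.PropositionalEquality using (_≡_)

data IFm : Set where
  ivar : ℕ → IFm
  i⊥   : IFm
  _i∧_ _i∨_ _i⇒_ : IFm → IFm → IFm
  i∀ i∃ : IFm → IFm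

infixr 6 _i∧_
infixr 5 _i∨_
infixr 4 _i⇒_

_i⇔_ : IFm → IFm → IFm
φ i⇔ ψ = (φ i⇒ ψ) i∧ (ψ i⇒ φ)

isubst : (ℕ → IFm) → IFm → IFm
isubst σ (ivar n) = σ n
isubst σ i⊥ = i⊥
isubst σ (φ i∧ ψ) = isubst σ φ i∧ isubst σ ψ
isubst σ (φ i∨ ψ) = isubst σ φ i∨ isubst σ ψ
isubst σ (φ i⇒ ψ) = isubst σ φ i⇒ isubst σ ψ
isubst σ (i∀ φ) = i∀ (isubst σ φ)
isubst σ (i∃ φ) = i∃ (isubst σ φ)

data IPCAx : IFm → Set where
  ax1 : ∀ φ ψ → IPCAx (φ i⇒ (ψ i⇒ φ))
  ax2 : ∀ φ ψ χ → IPCAx ((φ i⇒ (ψ i⇒ χ)) i⇒ ((φ i⇒ ψ) i⇒ (φ i⇒ χ)))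
  ax3 : ∀ φ ψ → IPCAx ((φ i∧ ψ) i⇒ φ)
  ax4 : ∀ φ ψ → IPCAx ((φ i∧ ψ) i⇒ ψ)
  ax5 : ∀ φ ψ → IPCAx (φ i⇒ (ψ i⇒ (φ i∧ ψ)))
  ax6 : ∀ φ ψ → IPCAx (φ i⇒ (φ i∨ ψ))
  ax7 : ∀ φ ψ → IPCAx (ψ i⇒ (φ i∨ ψ))
  ax8 : ∀ φ ψ χ → IPCAx ((φ i⇒ χ) i⇒ ((ψ i⇒ χ) i⇒ ((φ i∨ ψ) i⇒ χ)))
  ax9 : ∀ φ → IPCAx (i⊥ i⇒ φ)

module _ where
  private
    p q : IFm
    p = ivar 0
    q = ivar 1

  data MIPCAx : IFm → Set where
    ∀∧  : MIPCAx (i∀ (p i∧ q) i⇔ (i∀ p i∧ i∀ q))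
    ∀T  : MIPCAx (i∀ p i⇒ p)
    ∀4  : MIPCAx (i∀ p i⇒ i∀ (i∀ p))
    ∃∨  : MIPCAx (i∃ (p i∨ q) i⇔ (i∃ p i∨ i∃ q))
    ∃T  : MIPCAx (p i⇒ i∃ p)
    ∃4  : MIPCAx (i∃ (i∃ p) i⇒ i∃ p)
    ∃∃  : MIPCAx ((i∃ p i∧ i∃ q) i⇒ i∃ (i∃ p i∧ q))
    ∃∀  : MIPCAx (i∃ (i∀ p) i⇒ i∀ p)
    ∃∀∃ : MIPCAx (i∃ p i⇒ i∀ (i∃ p))

data MIPC⊢_ : IFm → Set where
  ipc   : ∀ {φ} → IPCAx φ → MIPC⊢ φ
  max   : ∀ {φ} → MIPCAx φ → MIPC⊢ φ
  mp    : ∀ {φ ψ} → MIPC⊢ (φ i⇒ ψ) → MIPC⊢ φ → MIPC⊢ ψ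
  sub   : ∀ {φ} (σ : ℕ → IFm) → MIPC⊢ φ → MIPC⊢ isubst σ φ
  gen∀  : ∀ {φ} → MIPC⊢ φ → MIPC⊢ i∀ φ

data Fm : Set where
  var : ℕ → Fm
  ⊥'  : Fm
  _∧'_ _∨'_ _⇒_ : Fm → Fm → Fm
  □ ∀' : Fm → Fm

infixr 6 _∧'_
infixr 5 _∨'_
infixr 4 _⇒_

¬' : Fm → Fm
¬' φ = φ ⇒ ⊥'

◇ : Fm → Fm
◇ φ = ¬' (□ (¬' φ))

∃' : Fm → Fm
∃' φ = ¬' (∀' (¬' φ))

subst' : (ℕ → Fm) → Fm → Fm
subst' σ (var n) = σ n
subst' σ ⊥' = ⊥'
subst' σ (φ ∧' ψ) = subst' σ φ ∧' subst' σ ψ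
subst' σ (φ ∨' ψ) = subst' σ φ ∨' subst' σ ψ
subst' σ (φ ⇒ ψ) = subst' σ φ ⇒ subst' σ ψ
subst' σ (□ φ) = □ (subst' σ φ)
subst' σ (∀' φ) = ∀' (subst' σ φ)

data CPCAx : Fm → Set where
  ax1 : ∀ φ ψ → CPCAx (φ ⇒ (ψ ⇒ φ))
  ax2 : ∀ φ ψ χ → CPCAx ((φ ⇒ (ψ ⇒ χ)) ⇒ ((φ ⇒ ψ) ⇒ (φ ⇒ χ)))
  ax3 : ∀ φ ψ → CPCAx ((φ ∧' ψ) ⇒ φ)
  ax4 : ∀ φ ψ → CPCAx ((φ ∧' ψ) ⇒ ψ)
  ax5 : ∀ φ ψ → CPCAx (φ ⇒ (ψ ⇒ (φ ∧' ψ)))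
  ax6 : ∀ φ ψ → CPCAx (φ ⇒ (φ ∨' ψ))
  ax7 : ∀ φ ψ → CPCAx (ψ ⇒ (φ ∨' ψ))
  ax8 : ∀ φ ψ χ → CPCAx ((φ ⇒ χ) ⇒ ((ψ ⇒ χ) ⇒ ((φ ∨' ψ) ⇒ χ)))
  ax9 : ∀ φ → CPCAx (⊥' ⇒ φ)
  dne : ∀ φ → CPCAx (¬' (¬' φ) ⇒ φ)

module _ where
  private
    p q : Fm
    p = var 0
    q = var 1

  data MS4Ax : Fm → Set where
    □K  : MS4Ax (□ (p ⇒ q) ⇒ (□ p ⇒ □ q))
    □T  : MS4Ax (□ p ⇒ p)
    □4  : MS4Ax (□ p ⇒ □ (□ p))
    ∀K  : MS4Ax (∀' (p ⇒ q) ⇒ (∀' p ⇒ ∀' q))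
    ∀T  : MS4Ax (∀' p ⇒ p)
    ∀4  : MS4Ax (∀' p ⇒ ∀' (∀' p))
    ∀5  : MS4Ax (∃' p ⇒ ∀' (∃' p))
    com : MS4Ax (□ (∀' p) ⇒ ∀' (□ p))

  grz : Fm
  grz = □ (□ (p ⇒ □ p) ⇒ p) ⇒ p

  kur : Fm
  kur = □ (∀' (◇ (□ p))) ⇒ ◇ (∀' p)

data _⊢_ (Ax : Fm → Set) : Fm → Set where
  cpc  : ∀ {φ} → CPCAx φ → Ax ⊢ φ
  ms4  : ∀ {φ} → MS4Ax φ → Ax ⊢ φ
  extra : ∀ {φ} → Ax φ → Ax ⊢ φ
  mp   : ∀ {φ ψ} → Ax ⊢ (φ ⇒ ψ) → Ax ⊢ φ → Ax ⊢ ψ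
  sub  : ∀ {φ} (σ : ℕ → Fm) → Ax ⊢ φ → Ax ⊢ subst' σ φ
  nec□ : ∀ {φ} → Ax ⊢ φ → Ax ⊢ □ φ
  nec∀ : ∀ {φ} → Ax ⊢ φ → Ax ⊢ ∀' φ

MGrz∨LKur-Ax : Fm → Set
MGrz∨LKur-Ax ψ = (ψ ≡ grz) ⊎ (ψ ≡ kur)

_ᵗ : IFm → Fm
ivar n ᵗ = □ (var n)
i⊥ ᵗ = ⊥'
(φ i∧ ψ) ᵗ = (φ ᵗ) ∧' (ψ ᵗ)
(φ i∨ ψ) ᵗ = (φ ᵗ) ∨' (ψ ᵗ)
(φ i⇒ ψ) ᵗ = □ (¬' (φ ᵗ) ∨' (ψ ᵗ))
i∀ φ ᵗ = □ (∀' (φ ᵗ))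
i∃ φ ᵗ = ∃' (φ ᵗ)

ModalCompanion : (Fm → Set) → Set
ModalCompanion Ax = ∀ (φ : IFm) → (MIPC⊢ φ → Ax ⊢ (φ ᵗ)) × (Ax ⊢ (φ ᵗ) → MIPC⊢ φ)

-- The intuitionistic Kuroda formula ∀¬¬p → ¬¬∀p is not a theorem of MIPC: it fails in
-- the three-element chain 0 < ½ < 1 with ∀ and ∃ the interior and closure operators onto
-- {0, 1}, at p = ½.  Its Gödel translation is nevertheless derivable in MGrz ∨ LKur: it
-- amounts to □∀□◇□p → □◇□∀□p, which follows from the Kuroda axiom (instantiated at □p)
-- followed by the McKinsey axiom □◇x → ◇□x, a theorem of MS4 + Grz.
module Submission where

open import Defs
open import Relation.Nullary using (¬_)
open import Data.Nat using (ℕ)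
open import Data.Product using (_,_; proj₂)
open import Data.Sum using (inj₁; inj₂)
open import Relation.Binary.PropositionalEquality using (_≡_; refl; trans; cong; cong₂)
open import Relation.Nullary.Decidable using (Dec; yes; no; True; toWitness; map′; _×-dec_)

private
  p q r : IFm
  p = ivar 0
  q = ivar 1
  r = ivar 2

¬ᵢ_ : IFm → IFm
¬ᵢ φ = φ i⇒ i⊥

Kuroda : IFm
Kuroda = i∀ (¬ᵢ ¬ᵢ p) i⇒ ¬ᵢ ¬ᵢ i∀ p

data Three : Set where
  bot mid top : Three

_⊓_ _⊔_ _⇨_ : Three → Three → Three
bot ⊓ _   = bot
mid ⊓ bot = bot
mid ⊓ _   = mid
top ⊓ b   = b

bot ⊔ b   = b
mid ⊔ top = top
mid ⊔ _   = mid
top ⊔ _   = top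

bot ⇨ _   = top
mid ⇨ bot = bot
mid ⇨ _   = top
top ⇨ b   = b

interior closure : Three → Three
interior top = top
interior _   = bot

closure bot = bot
closure _   = top

⟦_⟧ : IFm → (ℕ → Three) → Three
⟦ ivar n ⟧ v = v n
⟦ i⊥ ⟧ v     = bot
⟦ φ i∧ ψ ⟧ v = ⟦ φ ⟧ v ⊓ ⟦ ψ ⟧ v
⟦ φ i∨ ψ ⟧ v = ⟦ φ ⟧ v ⊔ ⟦ ψ ⟧ v
⟦ φ i⇒ ψ ⟧ v = ⟦ φ ⟧ v ⇨ ⟦ ψ ⟧ v
⟦ i∀ φ ⟧ v   = interior (⟦ φ ⟧ v)
⟦ i∃ φ ⟧ v   = closure (⟦ φ ⟧ v)

Valid : IFm → Set
Valid φ = ∀ v → ⟦ φ ⟧ v ≡ top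

⟦⟧-isubst : ∀ σ φ v → ⟦ isubst σ φ ⟧ v ≡ ⟦ φ ⟧ (λ n → ⟦ σ n ⟧ v)
⟦⟧-isubst σ (ivar n) v = refl
⟦⟧-isubst σ i⊥       v = refl
⟦⟧-isubst σ (φ i∧ ψ) v = cong₂ _⊓_ (⟦⟧-isubst σ φ v) (⟦⟧-isubst σ ψ v)
⟦⟧-isubst σ (φ i∨ ψ) v = cong₂ _⊔_ (⟦⟧-isubst σ φ v) (⟦⟧-isubst σ ψ v)
⟦⟧-isubst σ (φ i⇒ ψ) v = cong₂ _⇨_ (⟦⟧-isubst σ φ v) (⟦⟧-isubst σ ψ v)
⟦⟧-isubst σ (i∀ φ)   v = cong interior (⟦⟧-isubst σ φ v)
⟦⟧-isubst σ (i∃ φ)   v = cong closure (⟦⟧-isubst σ φ v)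

∀-Three? : {P : Three → Set} → (∀ a → Dec (P a)) → Dec (∀ a → P a)
∀-Three? P? = map′ (λ { (pb , pm , pt) → λ { bot → pb ; mid → pm ; top → pt } })
                   (λ ∀P → ∀P bot , ∀P mid , ∀P top)
                   (P? bot ×-dec P? mid ×-dec P? top)

≟top : (a : Three) → Dec (a ≡ top)
≟top bot = no λ ()
≟top mid = no λ ()
≟top top = yes refl

-- Variables beyond 2 also get the value c; the axiom schemes only use 0, 1, 2.
valuation₃ : Three → Three → Three → ℕ → Three
valuation₃ a b c 0 = a
valuation₃ a b c 1 = b
valuation₃ a b c _ = c

Valid₃ : IFm → Set
Valid₃ φ = ∀ a b c → ⟦ φ ⟧ (valuation₃ a b c) ≡ top

valid₃? : ∀ φ → Dec (Valid₃ φ)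
valid₃? φ = ∀-Three? λ a → ∀-Three? λ b → ∀-Three? λ c → ≟top (⟦ φ ⟧ (valuation₃ a b c))

tautology₃ : ∀ φ → {True (valid₃? φ)} → Valid₃ φ
tautology₃ φ {t} = toWitness t

-- An IPC axiom instance evaluates exactly like its scheme in the variables 0, 1, 2.
IPCAx-valid : ∀ {φ} → IPCAx φ → Valid φ
IPCAx-valid (ax1 φ ψ)   v = tautology₃ (p i⇒ q i⇒ p) (⟦ φ ⟧ v) (⟦ ψ ⟧ v) bot
IPCAx-valid (ax2 φ ψ χ) v =
  tautology₃ ((p i⇒ q i⇒ r) i⇒ (p i⇒ q) i⇒ p i⇒ r) (⟦ φ ⟧ v) (⟦ ψ ⟧ v) (⟦ χ ⟧ v)
IPCAx-valid (ax3 φ ψ)   v = tautology₃ (p i∧ q i⇒ p) (⟦ φ ⟧ v) (⟦ ψ ⟧ v) bot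
IPCAx-valid (ax4 φ ψ)   v = tautology₃ (p i∧ q i⇒ q) (⟦ φ ⟧ v) (⟦ ψ ⟧ v) bot
IPCAx-valid (ax5 φ ψ)   v = tautology₃ (p i⇒ q i⇒ p i∧ q) (⟦ φ ⟧ v) (⟦ ψ ⟧ v) bot
IPCAx-valid (ax6 φ ψ)   v = tautology₃ (p i⇒ p i∨ q) (⟦ φ ⟧ v) (⟦ ψ ⟧ v) bot
IPCAx-valid (ax7 φ ψ)   v = tautology₃ (q i⇒ p i∨ q) (⟦ φ ⟧ v) (⟦ ψ ⟧ v) bot
IPCAx-valid (ax8 φ ψ χ) v =
  tautology₃ ((p i⇒ r) i⇒ (q i⇒ r) i⇒ p i∨ q i⇒ r) (⟦ φ ⟧ v) (⟦ ψ ⟧ v) (⟦ χ ⟧ v)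
IPCAx-valid (ax9 φ)     v = tautology₃ (i⊥ i⇒ p) (⟦ φ ⟧ v) bot bot

MIPCAx-valid : ∀ {φ} → MIPCAx φ → Valid φ
MIPCAx-valid {φ} ∀∧  v = tautology₃ φ (v 0) (v 1) bot
MIPCAx-valid {φ} ∀T  v = tautology₃ φ (v 0) bot bot
MIPCAx-valid {φ} ∀4  v = tautology₃ φ (v 0) bot bot
MIPCAx-valid {φ} ∃∨  v = tautology₃ φ (v 0) (v 1) bot
MIPCAx-valid {φ} ∃T  v = tautology₃ φ (v 0) bot bot
MIPCAx-valid {φ} ∃4  v = tautology₃ φ (v 0) bot bot
MIPCAx-valid {φ} ∃∃  v = tautology₃ φ (v 0) (v 1) bot
MIPCAx-valid {φ} ∃∀  v = tautology₃ φ (v 0) bot bot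
MIPCAx-valid {φ} ∃∀∃ v = tautology₃ φ (v 0) bot bot

⇨-top : ∀ {a b} → a ⇨ b ≡ top → a ≡ top → b ≡ top
⇨-top a⇨b≡top refl = a⇨b≡top

MIPC-sound : ∀ {φ} → MIPC⊢ φ → Valid φ
MIPC-sound (ipc ax) v = IPCAx-valid ax v
MIPC-sound (max ax) v = MIPCAx-valid ax v
MIPC-sound (mp ⊢φ⇒ψ ⊢φ) v = ⇨-top (MIPC-sound ⊢φ⇒ψ v) (MIPC-sound ⊢φ v)
MIPC-sound (sub {φ} σ ⊢φ) v = trans (⟦⟧-isubst σ φ v) (MIPC-sound ⊢φ (λ n → ⟦ σ n ⟧ v))
MIPC-sound (gen∀ ⊢φ) v = cong interior (MIPC-sound ⊢φ v)

Kuroda-unprovable : ¬ (MIPC⊢ Kuroda)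
Kuroda-unprovable ⊢Kuroda with MIPC-sound ⊢Kuroda (λ _ → mid)
... | ()

substitution₂ : Fm → Fm → ℕ → Fm
substitution₂ a b 0 = a
substitution₂ a b _ = b

module _ {Ax : Fm → Set} where

  axK : ∀ a b → Ax ⊢ (a ⇒ b ⇒ a)
  axK a b = cpc (ax1 a b)

  axS : ∀ a b c → Ax ⊢ ((a ⇒ b ⇒ c) ⇒ (a ⇒ b) ⇒ a ⇒ c)
  axS a b c = cpc (ax2 a b c)

  ⇒-refl : ∀ a → Ax ⊢ (a ⇒ a)
  ⇒-refl a = mp (mp (axS a (a ⇒ a) a) (axK a (a ⇒ a))) (axK a a)

  ⇒-weaken : ∀ {a b} → Ax ⊢ b → Ax ⊢ (a ⇒ b)
  ⇒-weaken {a} {b} ⊢b = mp (axK b a) ⊢b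

  ⇒-mp : ∀ {a b c} → Ax ⊢ (a ⇒ b ⇒ c) → Ax ⊢ (a ⇒ b) → Ax ⊢ (a ⇒ c)
  ⇒-mp {a} {b} {c} ⊢a⇒b⇒c ⊢a⇒b = mp (mp (axS a b c) ⊢a⇒b⇒c) ⊢a⇒b

  ⇒-trans : ∀ {a b c} → Ax ⊢ (a ⇒ b) → Ax ⊢ (b ⇒ c) → Ax ⊢ (a ⇒ c)
  ⇒-trans ⊢a⇒b ⊢b⇒c = ⇒-mp (⇒-weaken ⊢b⇒c) ⊢a⇒b

  ⇒-mp₂ : ∀ {c a b d} → Ax ⊢ (c ⇒ a) → Ax ⊢ (c ⇒ b) → Ax ⊢ (a ⇒ b ⇒ d) → Ax ⊢ (c ⇒ d)
  ⇒-mp₂ ⊢c⇒a ⊢c⇒b ⊢a⇒b⇒d = ⇒-mp (⇒-trans ⊢c⇒a ⊢a⇒b⇒d) ⊢c⇒b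

  ⇒-postcompose : ∀ a b c → Ax ⊢ ((b ⇒ c) ⇒ (a ⇒ b) ⇒ a ⇒ c)
  ⇒-postcompose a b c = ⇒-trans (axK (b ⇒ c) a) (axS a b c)

  ⇒-precompose : ∀ {a b} → Ax ⊢ (a ⇒ b) → ∀ c → Ax ⊢ ((b ⇒ c) ⇒ a ⇒ c)
  ⇒-precompose {a} {b} ⊢a⇒b c = ⇒-mp (⇒-postcompose a b c) (⇒-weaken ⊢a⇒b)

  ⇒-swap : ∀ a b c → Ax ⊢ ((a ⇒ b ⇒ c) ⇒ b ⇒ a ⇒ c)
  ⇒-swap a b c = ⇒-trans (axS a b c) (⇒-precompose (axK b a) (a ⇒ c))

  ⇒-flip : ∀ {a b c} → Ax ⊢ (a ⇒ b ⇒ c) → Ax ⊢ (b ⇒ a ⇒ c)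
  ⇒-flip {a} {b} {c} = mp (⇒-swap a b c)

  contraposition : ∀ a b → Ax ⊢ ((a ⇒ b) ⇒ ¬' b ⇒ ¬' a)
  contraposition a b = ⇒-flip (⇒-postcompose a b ⊥')

  contrapose : ∀ {a b} → Ax ⊢ (a ⇒ b) → Ax ⊢ (¬' b ⇒ ¬' a)
  contrapose {a} {b} = mp (contraposition a b)

  ∧-curry : ∀ {a b c} → Ax ⊢ (a ∧' b ⇒ c) → Ax ⊢ (a ⇒ b ⇒ c)
  ∧-curry {a} {b} {c} ⊢a∧b⇒c = ⇒-trans (cpc (ax5 a b)) (mp (⇒-postcompose b (a ∧' b) c) ⊢a∧b⇒c)

  excluded-middle : ∀ a → Ax ⊢ (a ∨' ¬' a)
  excluded-middle a =
    mp (cpc (dne (a ∨' ¬' a)))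
       (⇒-mp₂ (contrapose (cpc (ax7 a (¬' a)))) (contrapose (cpc (ax6 a (¬' a))))
              (⇒-refl (¬' (¬' a))))

  ⇒-to-¬∨ : ∀ {a b} → Ax ⊢ (a ⇒ b) → Ax ⊢ (¬' a ∨' b)
  ⇒-to-¬∨ {a} {b} ⊢a⇒b =
    mp (mp (mp (cpc (ax8 a (¬' a) (¬' a ∨' b))) (⇒-trans ⊢a⇒b (cpc (ax7 (¬' a) b))))
           (cpc (ax6 (¬' a) b)))
       (excluded-middle a)

  ∨⊥-elim : ∀ a → Ax ⊢ (a ∨' ⊥' ⇒ a)
  ∨⊥-elim a = mp (mp (cpc (ax8 a ⊥' a)) (⇒-refl a)) (cpc (ax9 a))

  instance₁ : ∀ {φ} → Ax ⊢ φ → ∀ a → Ax ⊢ subst' (λ _ → a) φ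
  instance₁ ⊢φ a = sub (λ _ → a) ⊢φ

  instance₂ : ∀ {φ} → Ax ⊢ φ → ∀ a b → Ax ⊢ subst' (substitution₂ a b) φ
  instance₂ ⊢φ a b = sub (substitution₂ a b) ⊢φ

  □-K : ∀ a b → Ax ⊢ (□ (a ⇒ b) ⇒ □ a ⇒ □ b)
  □-K = instance₂ (ms4 □K)

  □-T : ∀ a → Ax ⊢ (□ a ⇒ a)
  □-T = instance₁ (ms4 □T)

  □-4 : ∀ a → Ax ⊢ (□ a ⇒ □ (□ a))
  □-4 = instance₁ (ms4 □4)

  □-mono : ∀ {a b} → Ax ⊢ (a ⇒ b) → Ax ⊢ (□ a ⇒ □ b)
  □-mono {a} {b} ⊢a⇒b = mp (□-K a b) (nec□ ⊢a⇒b)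

  ∀-mono : ∀ {a b} → Ax ⊢ (a ⇒ b) → Ax ⊢ (∀' a ⇒ ∀' b)
  ∀-mono {a} {b} ⊢a⇒b = mp (instance₂ (ms4 ∀K) a b) (nec∀ ⊢a⇒b)

  ◇-mono : ∀ {a b} → Ax ⊢ (a ⇒ b) → Ax ⊢ (◇ a ⇒ ◇ b)
  ◇-mono ⊢a⇒b = contrapose (□-mono (contrapose ⊢a⇒b))

  ◇-K : ∀ a b → Ax ⊢ (□ (a ⇒ b) ⇒ ◇ a ⇒ ◇ b)
  ◇-K a b = ⇒-trans (⇒-trans (□-mono (contraposition a b)) (□-K (¬' b) (¬' a)))
                    (contraposition (□ (¬' b)) (□ (¬' a)))

  □-∧ : ∀ a b → Ax ⊢ (□ a ⇒ □ b ⇒ □ (a ∧' b))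
  □-∧ a b = ⇒-trans (□-mono (cpc (ax5 a b))) (□-K b (a ∧' b))

  □-intro-closed : ∀ {c b} → Ax ⊢ (c ⇒ □ c) → Ax ⊢ (c ⇒ b) → Ax ⊢ (c ⇒ □ b)
  □-intro-closed ⊢c⇒□c ⊢c⇒b = ⇒-trans ⊢c⇒□c (□-mono ⊢c⇒b)

  □-intro : ∀ {a b} → Ax ⊢ (□ a ⇒ b) → Ax ⊢ (□ a ⇒ □ b)
  □-intro = □-intro-closed (□-4 _)

  □∨⊥⇒□ : ∀ a → Ax ⊢ (□ (a ∨' ⊥') ⇒ □ a)
  □∨⊥⇒□ a = □-mono (∨⊥-elim a)

  □⇒□∨⊥ : ∀ a → Ax ⊢ (□ a ⇒ □ (a ∨' ⊥'))
  □⇒□∨⊥ a = □-mono (cpc (ax6 a ⊥'))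

  ¬¬ᵗ⇒□◇ : ∀ φ → Ax ⊢ ((¬ᵢ ¬ᵢ φ) ᵗ ⇒ □ (◇ (φ ᵗ)))
  ¬¬ᵗ⇒□◇ φ = ⇒-trans (□∨⊥⇒□ _) (□-mono (contrapose (□⇒□∨⊥ (¬' (φ ᵗ)))))

  □◇⇒¬¬ᵗ : ∀ φ → Ax ⊢ (□ (◇ (φ ᵗ)) ⇒ (¬ᵢ ¬ᵢ φ) ᵗ)
  □◇⇒¬¬ᵗ φ = ⇒-trans (□-mono (contrapose (□∨⊥⇒□ (¬' (φ ᵗ))))) (□⇒□∨⊥ _)

module _ {Ax : Fm → Set} (grz∈Ax : Ax grz) where

  -- The hypothesis H = □◇x ∧ □¬□x is □-closed and refutes □(x ⇒ □x), so it proves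
  -- □(□(x ⇒ □x) ⇒ x) vacuously; Grz then yields x, hence □x, contradicting □¬□x.
  mckinsey : ∀ x → Ax ⊢ (□ (◇ x) ⇒ ◇ (□ x))
  mckinsey x = ∧-curry H⇒⊥
    where
    H = □ (◇ x) ∧' □ (¬' (□ x))

    H⇒□H : Ax ⊢ (H ⇒ □ H)
    H⇒□H = ⇒-mp₂ (⇒-trans (cpc (ax3 _ _)) (□-4 _)) (⇒-trans (cpc (ax4 _ _)) (□-4 _)) (□-∧ _ _)

    H⇒□¬□x : Ax ⊢ (H ⇒ □ (¬' (□ x)))
    H⇒□¬□x = cpc (ax4 _ _)

    H⇒¬□[x⇒□x] : Ax ⊢ (H ⇒ ¬' (□ (x ⇒ □ x)))
    H⇒¬□[x⇒□x] =
      ⇒-mp₂ (⇒-trans (⇒-trans (cpc (ax3 _ _)) (□-T _)) (⇒-flip (◇-K x (□ x)))) H⇒□¬□x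
            (⇒-swap (□ (x ⇒ □ x)) (□ (¬' (□ x))) ⊥')

    H⇒grz-premise : Ax ⊢ (H ⇒ □ (□ (x ⇒ □ x) ⇒ x))
    H⇒grz-premise =
      □-intro-closed H⇒□H (⇒-trans H⇒¬□[x⇒□x] (mp (⇒-postcompose _ ⊥' x) (cpc (ax9 x))))

    H⇒□x : Ax ⊢ (H ⇒ □ x)
    H⇒□x = □-intro-closed H⇒□H (⇒-trans H⇒grz-premise (instance₁ (extra grz∈Ax) x))

    H⇒⊥ : Ax ⊢ (H ⇒ ⊥')
    H⇒⊥ = ⇒-mp₂ (⇒-trans H⇒□¬□x (□-T _)) H⇒□x (⇒-refl _)

  Kurodaᵗ-derivable : Ax kur → Ax ⊢ (Kuroda ᵗ)
  Kurodaᵗ-derivable kur∈Ax =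
    nec□ (⇒-to-¬∨ (⇒-trans premise⇒B (⇒-trans (□-intro B⇒◇□∀□p) (□◇⇒¬¬ᵗ (i∀ p)))))
    where
    B = □ (∀' (◇ (□ (p ᵗ))))

    premise⇒B : Ax ⊢ ((i∀ (¬ᵢ ¬ᵢ p)) ᵗ ⇒ B)
    premise⇒B = □-mono (∀-mono (⇒-trans (¬¬ᵗ⇒□◇ p) (⇒-trans (□-T _) (◇-mono (□-4 _)))))

    B⇒◇□∀□p : Ax ⊢ (B ⇒ ◇ ((i∀ p) ᵗ))
    B⇒◇□∀□p = ⇒-trans (□-intro (instance₁ (extra kur∈Ax) (p ᵗ))) (mckinsey (∀' (p ᵗ)))

proposition5p5 : ¬ ModalCompanion MGrz∨LKur-Ax
proposition5p5 companion =
  Kuroda-unprovable (proj₂ (companion Kuroda) (Kurodaᵗ-derivable (inj₁ refl) (inj₂ refl)))
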